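{- In classical propositional logic (in the two-sorted language described in the context), every formula $A$ is ${\sf par}$-projective. Moreover, for every formula $A$, the formula $\mathrm{U}(A)\to A$ is projective, where $\mathrm{U}(A)$ denotes the uniform post-interpolant of $A$ with respect to ${\sf par}$.
   Context: The language $\mathcal{L}$ is built from atoms ${\sf atom}={\sf var}\cup{\sf par}$, where ${\sf var}$ (variables) and ${\sf par}$ (parameters) are disjoint infinite sets, using $\bot,\wedge,\vee,\to$; $\top:=\bot\to\bot$, $\neg A:=A\to\bot$. $\mathcal{L}({\sf par})$ is the set of formulas containing only parameters as atoms. A substitution is a map $\theta:\mathcal{L}\to\mathcal{L}$ commuting with all connectives and with $\theta(p)=p$ for all $p\in{\sf par}$. $\vdash$ denotes classical derivability. $\theta$ is an $A$-identity if $A\vdash\theta(a)\leftrightarrow a$ for every atom $a$. For $E\in\mathcal{L}({\sf par})$, $\theta$ is an $E$-fier of $A$ if $\vdash\theta(A)\leftrightarrow E$. $A$ is $E$-projective if some $\theta$ is both an $A$-identity and an $E$-fier of $A$; $A$ is ${\sf par}$-projective if it is $E$-projective for some $E\in\mathcal{L}({\sf par})$; $A$ is projective if it is $\top$-projective (i.e. some $A$-identity $\theta$ has $\vdash\theta(A)$). The uniform post-interpolant $\mathrm{U}(A)$ of $A$ w.r.t. ${\sf par}$ is a formula $B\in\mathcal{L}({\sf par})$ with $\vdash A\to B$ and $\vdash B\to C$ for every $C\in\mathcal{L}({\sf par})$ with $\vdash A\to C$ (it exists in classical logic and is unique up to provable equivalence). -}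

module Defs where

open import Data.Nat using (ℕ)
open import Data.List using (List; []; _∷_)
open import Data.List.Membership.Propositional using (_∈_)
open import Data.Product using (Σ; _×_)

data Atom : Set where
  var : ℕ → Atom
  par : ℕ → Atom

infixr 6 _∧_
infixr 5 _∨_
infixr 4 _⇒_
data Form : Set where
  at  : Atom → Form
  ⊥′  : Form
  _∧_ : Form → Form → Form
  _∨_ : Form → Form → Form
  _⇒_ : Form → Form → Form

⊤′ : Form
⊤′ = ⊥′ ⇒ ⊥′

¬′_ : Form → Form
¬′ A = A ⇒ ⊥′

infix 3 _⇔_
_⇔_ : Form → Form → Form
A ⇔ B = (A ⇒ B) ∧ (B ⇒ A)

data ParOnly : Form → Set where
  par-at : ∀ n → ParOnly (at (par n))
  par-⊥  : ParOnly ⊥′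
  par-∧  : ∀ {A B} → ParOnly A → ParOnly B → ParOnly (A ∧ B)
  par-∨  : ∀ {A B} → ParOnly A → ParOnly B → ParOnly (A ∨ B)
  par-⇒  : ∀ {A B} → ParOnly A → ParOnly B → ParOnly (A ⇒ B)

infix 1 _⊢_
data _⊢_ (Γ : List Form) : Form → Set where
  hyp  : ∀ {A} → A ∈ Γ → Γ ⊢ A
  raa  : ∀ {A} → (¬′ A ∷ Γ) ⊢ ⊥′ → Γ ⊢ A
  ∧I   : ∀ {A B} → Γ ⊢ A → Γ ⊢ B → Γ ⊢ A ∧ B
  ∧E₁  : ∀ {A B} → Γ ⊢ A ∧ B → Γ ⊢ A
  ∧E₂  : ∀ {A B} → Γ ⊢ A ∧ B → Γ ⊢ B
  ∨I₁  : ∀ {A B} → Γ ⊢ A → Γ ⊢ A ∨ B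
  ∨I₂  : ∀ {A B} → Γ ⊢ B → Γ ⊢ A ∨ B
  ∨E   : ∀ {A B C} → Γ ⊢ A ∨ B → (A ∷ Γ) ⊢ C → (B ∷ Γ) ⊢ C → Γ ⊢ C
  ⇒I   : ∀ {A B} → (A ∷ Γ) ⊢ B → Γ ⊢ A ⇒ B
  ⇒E   : ∀ {A B} → Γ ⊢ A ⇒ B → Γ ⊢ A → Γ ⊢ B

infix 1 ⊢_
⊢_ : Form → Set
⊢ A = [] ⊢ A

-- Substitutions: determined by the images of variables; parameters are fixed.
Subst : Set
Subst = ℕ → Form

substAtom : Subst → Atom → Form
substAtom θ (var n) = θ n
substAtom θ (par n) = at (par n)

subst : Subst → Form → Form
subst θ (at a)  = substAtom θ a
subst θ ⊥′      = ⊥′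
subst θ (A ∧ B) = subst θ A ∧ subst θ B
subst θ (A ∨ B) = subst θ A ∨ subst θ B
subst θ (A ⇒ B) = subst θ A ⇒ subst θ B

IsIdentity : Form → Subst → Set
IsIdentity A θ = ∀ (a : Atom) → (A ∷ []) ⊢ subst θ (at a) ⇔ at a

IsFier : Form → Form → Subst → Set
IsFier E A θ = ⊢ subst θ A ⇔ E

EProjective : Form → Form → Set
EProjective E A = Σ Subst λ θ → IsIdentity A θ × IsFier E A θ

ParProjective : Form → Set
ParProjective A = Σ Form λ E → ParOnly E × EProjective E A

Projective : Form → Set
Projective A = EProjective ⊤′ A

IsUPI : Form → Form → Set
IsUPI A B = ParOnly B × (⊢ A ⇒ B) × (∀ C → ParOnly C → ⊢ A ⇒ C → ⊢ B ⇒ C)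

-- By completeness everything reduces to truth tables. Eliminating the
-- variables of A one at a time (Shannon expansion B ↦ B[⊤/x] ∨ B[⊥/x])
-- yields a substitution σ with values in L(par) such that σ(A) holds at a
-- valuation exactly when A is satisfiable over its parameters; so σ(A) is
-- the uniform post-interpolant, and A ⊢ σ(A). Löwenheim's substitution
-- θ(x) = (B ∧ x) ∨ (¬B ∧ σ(x)) is a B-identity with θ(B) ≡ σ(B) whenever
-- B ⊢ σ(B). Taking B = A shows A is σ(A)-projective; taking B = U(A) → A gives
-- θ(B) ≡ U(A) → σ(A), which is provable because ⊢ A → σ(A) and σ(A) ∈ L(par).

module Submission where

open import Defs
open import Data.Bool using (Bool; true; false; not)
  renaming (_∧_ to _∧ᵇ_; _∨_ to _∨ᵇ_)
open import Data.Bool.Properties using (∨-identityʳ; ∨-zeroʳ)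
open import Data.List using (List; []; _∷_; _++_; map)
open import Data.List.Membership.Propositional using (_∈_)
open import Data.List.Membership.Propositional.Properties using (∈-map⁺)
open import Data.List.Relation.Binary.Subset.Propositional using (_⊆_)
open import Data.List.Relation.Binary.Subset.Propositional.Properties
  using (⊆-refl; ∷⁺ʳ; xs⊆x∷xs; xs⊆xs++ys; xs⊆ys++xs; ∈-∷⁺ʳ)
open import Data.List.Relation.Unary.All as All using (All; []; _∷_)
open import Data.List.Relation.Unary.Any using (here; there)
open import Data.Nat using (ℕ; zero; suc; _<_; _≤_; _⊔_; s≤s; _≟_)
open import Data.Nat.Properties using (≤∧≢⇒<; <-≤-trans; m≤m⊔n; m≤n⊔m; n<1+n)
open import Data.Product using (_×_; _,_)
open import Data.Unit using (⊤; tt)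
open import Function using (_∘_)
open import Relation.Binary.Definitions using (DecidableEquality)
open import Relation.Binary.PropositionalEquality
  using (_≡_; _≗_; refl; sym; trans; cong; cong₂; module ≡-Reasoning)
open import Relation.Nullary using (yes; no; contradiction)

-- Truth-table semantics

Val : Set
Val = Atom → Bool

⟦_⟧ : Form → Val → Bool
⟦ at a ⟧  v = v a
⟦ ⊥′ ⟧    v = false
⟦ A ∧ B ⟧ v = ⟦ A ⟧ v ∧ᵇ ⟦ B ⟧ v
⟦ A ∨ B ⟧ v = ⟦ A ⟧ v ∨ᵇ ⟦ B ⟧ v
⟦ A ⇒ B ⟧ v = not (⟦ A ⟧ v) ∨ᵇ ⟦ B ⟧ v

infix 2 _⊨_
_⊨_ : Val → Form → Set
v ⊨ A = ⟦ A ⟧ v ≡ true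

Tautology : Form → Set
Tautology A = ∀ v → v ⊨ A

⇒-⊨ : ∀ {v} A B → (v ⊨ A → v ⊨ B) → v ⊨ A ⇒ B
⇒-⊨ {v} A B f with ⟦ A ⟧ v
... | true  = f refl
... | false = refl

⇔-⊨ : ∀ {v} A B → ⟦ A ⟧ v ≡ ⟦ B ⟧ v → v ⊨ A ⇔ B
⇔-⊨ {v} A B eq rewrite eq with ⟦ B ⟧ v
... | true  = refl
... | false = refl

_≟ᵃ_ : DecidableEquality Atom
var m ≟ᵃ var n with m ≟ n
... | yes refl = yes refl
... | no m≢n   = no λ { refl → m≢n refl }
var m ≟ᵃ par n = no λ ()
par m ≟ᵃ var n = no λ ()
par m ≟ᵃ par n with m ≟ n
... | yes refl = yes refl
... | no m≢n   = no λ { refl → m≢n refl }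

_[_≔_] : Val → Atom → Bool → Val
(v [ a ≔ b ]) c with c ≟ᵃ a
... | yes _ = b
... | no _  = v c

update-same : ∀ v a b → (v [ a ≔ b ]) a ≡ b
update-same v a b with a ≟ᵃ a
... | yes _  = refl
... | no a≢a = contradiction refl a≢a

update-self : ∀ {v a b} → v a ≡ b → v [ a ≔ b ] ≗ v
update-self {a = a} va≡b c with c ≟ᵃ a
... | yes refl = sym va≡b
... | no _     = refl

weaken : ∀ {Γ Δ A} → Γ ⊆ Δ → Γ ⊢ A → Δ ⊢ A
weaken ρ (hyp A∈Γ)  = hyp (ρ A∈Γ)
weaken ρ (raa d)    = raa (weaken (∷⁺ʳ _ ρ) d)
weaken ρ (∧I d e)   = ∧I (weaken ρ d) (weaken ρ e)
weaken ρ (∧E₁ d)    = ∧E₁ (weaken ρ d)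
weaken ρ (∧E₂ d)    = ∧E₂ (weaken ρ d)
weaken ρ (∨I₁ d)    = ∨I₁ (weaken ρ d)
weaken ρ (∨I₂ d)    = ∨I₂ (weaken ρ d)
weaken ρ (∨E d e f) = ∨E (weaken ρ d) (weaken (∷⁺ʳ _ ρ) e) (weaken (∷⁺ʳ _ ρ) f)
weaken ρ (⇒I d)     = ⇒I (weaken (∷⁺ʳ _ ρ) d)
weaken ρ (⇒E d e)   = ⇒E (weaken ρ d) (weaken ρ e)

wk : ∀ {Γ A B} → Γ ⊢ A → B ∷ Γ ⊢ A
wk = weaken (xs⊆x∷xs _ _)

efq : ∀ {Γ A} → Γ ⊢ ⊥′ → Γ ⊢ A
efq d = raa (wk d)

excluded-middle : ∀ {Γ A} → Γ ⊢ A ∨ ¬′ A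
excluded-middle =
  raa (⇒E (hyp (here refl))
          (∨I₂ (⇒I (⇒E (hyp (there (here refl))) (∨I₁ (hyp (here refl)))))))

sound : ∀ {Γ A} → Γ ⊢ A → ∀ v → All (v ⊨_) Γ → v ⊨ A
sound (hyp A∈Γ) v H = All.lookup H A∈Γ
sound (raa {A} d) v H with ⟦ A ⟧ v in eq
... | true  = refl
... | false with () ← sound d v (cong (λ b → not b ∨ᵇ false) eq ∷ H)
sound (∧I d e) v H rewrite sound d v H | sound e v H = refl
sound (∧E₁ {A} d) v H with ⟦ A ⟧ v | sound d v H
... | true | _ = refl
sound (∧E₂ {A} d) v H with ⟦ A ⟧ v | sound d v H
... | true | ⊨B = ⊨B
sound (∨I₁ d) v H rewrite sound d v H = refl
sound (∨I₂ {A} d) v H rewrite sound d v H = ∨-zeroʳ (⟦ A ⟧ v)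
sound (∨E {A} d e f) v H with ⟦ A ⟧ v in eq | sound d v H
... | true  | _  = sound e v (eq ∷ H)
... | false | ⊨B = sound f v (⊨B ∷ H)
sound (⇒I {A} {B} d) v H = ⇒-⊨ A B (λ ⊨A → sound d v (⊨A ∷ H))
sound (⇒E {A} d e) v H with ⟦ A ⟧ v | sound d v H | sound e v H
... | true | ⊨B | _ = ⊨B

-- Completeness of NK (Kalmár)

signed : Bool → Form → Form
signed true  A = A
signed false A = ¬′ A

signed-true : ∀ {Γ b A} → b ≡ true → Γ ⊢ signed b A → Γ ⊢ A
signed-true refl d = d

signed-∧ : ∀ {Γ A B} b c → Γ ⊢ signed b A → Γ ⊢ signed c B → Γ ⊢ signed (b ∧ᵇ c) (A ∧ B)
signed-∧ true  true  d e = ∧I d e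
signed-∧ true  false d e = ⇒I (⇒E (wk e) (∧E₂ (hyp (here refl))))
signed-∧ false c     d e = ⇒I (⇒E (wk d) (∧E₁ (hyp (here refl))))

signed-∨ : ∀ {Γ A B} b c → Γ ⊢ signed b A → Γ ⊢ signed c B → Γ ⊢ signed (b ∨ᵇ c) (A ∨ B)
signed-∨ true  c     d e = ∨I₁ d
signed-∨ false true  d e = ∨I₂ e
signed-∨ false false d e =
  ⇒I (∨E (hyp (here refl)) (⇒E (wk (wk d)) (hyp (here refl)))
                           (⇒E (wk (wk e)) (hyp (here refl))))

signed-⇒ : ∀ {Γ A B} b c → Γ ⊢ signed b A → Γ ⊢ signed c B → Γ ⊢ signed (not b ∨ᵇ c) (A ⇒ B)
signed-⇒ false c     d e = ⇒I (efq (⇒E (wk d) (hyp (here refl))))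
signed-⇒ true  true  d e = ⇒I (wk e)
signed-⇒ true  false d e = ⇒I (⇒E (wk e) (⇒E (hyp (here refl)) (wk d)))

atoms : Form → List Atom
atoms (at a)  = a ∷ []
atoms ⊥′      = []
atoms (A ∧ B) = atoms A ++ atoms B
atoms (A ∨ B) = atoms A ++ atoms B
atoms (A ⇒ B) = atoms A ++ atoms B

literals : Val → List Atom → List Form
literals v = map (λ a → signed (v a) (at a))

kalmar : ∀ v L A → atoms A ⊆ L → literals v L ⊢ signed (⟦ A ⟧ v) A
kalmar v L (at a)  ⊆L = hyp (∈-map⁺ (λ c → signed (v c) (at c)) (⊆L (here refl)))
kalmar v L ⊥′      ⊆L = ⇒I (hyp (here refl))
kalmar v L (A ∧ B) ⊆L = signed-∧ (⟦ A ⟧ v) (⟦ B ⟧ v)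
  (kalmar v L A (⊆L ∘ xs⊆xs++ys _ _)) (kalmar v L B (⊆L ∘ xs⊆ys++xs _ (atoms A)))
kalmar v L (A ∨ B) ⊆L = signed-∨ (⟦ A ⟧ v) (⟦ B ⟧ v)
  (kalmar v L A (⊆L ∘ xs⊆xs++ys _ _)) (kalmar v L B (⊆L ∘ xs⊆ys++xs _ (atoms A)))
kalmar v L (A ⇒ B) ⊆L = signed-⇒ (⟦ A ⟧ v) (⟦ B ⟧ v)
  (kalmar v L A (⊆L ∘ xs⊆xs++ys _ _)) (kalmar v L B (⊆L ∘ xs⊆ys++xs _ (atoms A)))

literals-update : ∀ v a b L → literals (v [ a ≔ b ]) L ⊆ signed b (at a) ∷ literals v L
literals-update v a b (c ∷ L) (here refl) with c ≟ᵃ a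
... | yes refl = here refl
... | no _     = there (here refl)
literals-update v a b (c ∷ L) (there p) with literals-update v a b L p
... | here q  = here q
... | there q = there (there q)

literals-update-∷ : ∀ v a b L →
                    literals (v [ a ≔ b ]) (a ∷ L) ⊆ signed b (at a) ∷ literals v L
literals-update-∷ v a b L rewrite update-same v a b =
  ∈-∷⁺ʳ (here refl) (literals-update v a b L)

eliminate-literals : ∀ {A} L → (∀ v → literals v L ⊢ A) → ⊢ A
eliminate-literals [] H = H (λ _ → true)
eliminate-literals (a ∷ L) H = eliminate-literals L λ v →
  ∨E excluded-middle
     (weaken (literals-update-∷ v a true L)  (H (v [ a ≔ true ])))
     (weaken (literals-update-∷ v a false L) (H (v [ a ≔ false ])))

complete : ∀ {A} → Tautology A → ⊢ A
complete {A} ⊨A = eliminate-literals (atoms A) λ v →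
  signed-true (⊨A v) (kalmar v (atoms A) A ⊆-refl)

complete-⇔ : ∀ {A B} → (∀ v → ⟦ A ⟧ v ≡ ⟦ B ⟧ v) → ⊢ A ⇔ B
complete-⇔ {A} {B} eq = complete (λ v → ⇔-⊨ A B (eq v))

complete₁ : ∀ {A B} → (∀ v → v ⊨ A → v ⊨ B) → A ∷ [] ⊢ B
complete₁ {A} {B} A⊨B =
  ⇒E (weaken (λ ()) (complete (λ v → ⇒-⊨ A B (A⊨B v)))) (hyp (here refl))

_∘ˢ_ : Val → Subst → Val
(v ∘ˢ θ) (var n) = ⟦ θ n ⟧ v
(v ∘ˢ θ) (par n) = v (par n)

subst-⟦⟧ : ∀ {θ v u} C → v ∘ˢ θ ≗ u → ⟦ subst θ C ⟧ v ≡ ⟦ C ⟧ u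
subst-⟦⟧ (at (var n)) eq = eq (var n)
subst-⟦⟧ (at (par n)) eq = eq (par n)
subst-⟦⟧ ⊥′           eq = refl
subst-⟦⟧ (A ∧ B)      eq = cong₂ _∧ᵇ_ (subst-⟦⟧ A eq) (subst-⟦⟧ B eq)
subst-⟦⟧ (A ∨ B)      eq = cong₂ _∨ᵇ_ (subst-⟦⟧ A eq) (subst-⟦⟧ B eq)
subst-⟦⟧ (A ⇒ B)      eq = cong₂ (_∨ᵇ_ ∘ not) (subst-⟦⟧ A eq) (subst-⟦⟧ B eq)

ι : Subst
ι n = at (var n)

∘ˢ-ι : ∀ v → v ∘ˢ ι ≗ v
∘ˢ-ι v (var n) = refl
∘ˢ-ι v (par n) = refl

_[_↦_] : Subst → ℕ → Form → Subst
(σ [ N ↦ X ]) n with n ≟ N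
... | yes _ = X
... | no _  = σ n

[↦]-pointwise : ∀ {P : Form → Set} {σ N X} → P X → (∀ n → P (σ n)) → ∀ n → P ((σ [ N ↦ X ]) n)
[↦]-pointwise {N = N} PX Pσ n with n ≟ N
... | yes _ = PX
... | no _  = Pσ n

∘ˢ-update : ∀ {v σ u N X} → v ∘ˢ σ ≗ u → v ∘ˢ (σ [ N ↦ X ]) ≗ u [ var N ≔ ⟦ X ⟧ v ]
∘ˢ-update {N = N} eq (var n) with n ≟ N
... | yes refl = refl
... | no _     = eq (var n)
∘ˢ-update eq (par n) = eq (par n)

_⟨_≔_⟩ : Form → ℕ → Form → Form
B ⟨ N ≔ c ⟩ = subst (ι [ N ↦ c ]) B

instantiate-⟦⟧ : ∀ B {N c} v → ⟦ B ⟨ N ≔ c ⟩ ⟧ v ≡ ⟦ B ⟧ (v [ var N ≔ ⟦ c ⟧ v ])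
instantiate-⟦⟧ B v = subst-⟦⟧ B (∘ˢ-update (∘ˢ-ι v))

instantiate-own-value : ∀ B {N c} v → v (var N) ≡ ⟦ c ⟧ v → ⟦ B ⟨ N ≔ c ⟩ ⟧ v ≡ ⟦ B ⟧ v
instantiate-own-value B v eq =
  subst-⟦⟧ B (λ a → trans (∘ˢ-update (∘ˢ-ι v) a) (update-self eq a))

shannon-expansion : ∀ B N {v} → v ⊨ B → v ⊨ B ⟨ N ≔ ⊤′ ⟩ ∨ B ⟨ N ≔ ⊥′ ⟩
shannon-expansion B N {v} ⊨B with v (var N) in eq
... | true  = cong (_∨ᵇ ⟦ B ⟨ N ≔ ⊥′ ⟩ ⟧ v)
                   (trans (instantiate-own-value B v eq) ⊨B)
... | false = trans (cong (⟦ B ⟨ N ≔ ⊤′ ⟩ ⟧ v ∨ᵇ_)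
                          (trans (instantiate-own-value B v eq) ⊨B))
                    (∨-zeroʳ _)

subst-ParOnly : ∀ {C} → ParOnly C → ∀ θ → subst θ C ≡ C
subst-ParOnly (par-at n)  θ = refl
subst-ParOnly par-⊥       θ = refl
subst-ParOnly (par-∧ p q) θ = cong₂ _∧_ (subst-ParOnly p θ) (subst-ParOnly q θ)
subst-ParOnly (par-∨ p q) θ = cong₂ _∨_ (subst-ParOnly p θ) (subst-ParOnly q θ)
subst-ParOnly (par-⇒ p q) θ = cong₂ _⇒_ (subst-ParOnly p θ) (subst-ParOnly q θ)

ParOnly-subst : ∀ {σ} → (∀ n → ParOnly (σ n)) → ∀ C → ParOnly (subst σ C)
ParOnly-subst p (at (var n)) = p n
ParOnly-subst p (at (par n)) = par-at n
ParOnly-subst p ⊥′           = par-⊥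
ParOnly-subst p (A ∧ B)      = par-∧ (ParOnly-subst p A) (ParOnly-subst p B)
ParOnly-subst p (A ∨ B)      = par-∨ (ParOnly-subst p A) (ParOnly-subst p B)
ParOnly-subst p (A ⇒ B)      = par-⇒ (ParOnly-subst p A) (ParOnly-subst p B)

_≈ᵖ_ : Val → Val → Set
u ≈ᵖ w = ∀ n → u (par n) ≡ w (par n)

ParOnly-⟦⟧ : ∀ {C u w} → ParOnly C → u ≈ᵖ w → ⟦ C ⟧ u ≡ ⟦ C ⟧ w
ParOnly-⟦⟧ (par-at n)  eq = eq n
ParOnly-⟦⟧ par-⊥       eq = refl
ParOnly-⟦⟧ (par-∧ p q) eq = cong₂ _∧ᵇ_ (ParOnly-⟦⟧ p eq) (ParOnly-⟦⟧ q eq)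
ParOnly-⟦⟧ (par-∨ p q) eq = cong₂ _∨ᵇ_ (ParOnly-⟦⟧ p eq) (ParOnly-⟦⟧ q eq)
ParOnly-⟦⟧ (par-⇒ p q) eq = cong₂ (_∨ᵇ_ ∘ not) (ParOnly-⟦⟧ p eq) (ParOnly-⟦⟧ q eq)

VarsBelow : ℕ → Form → Set
VarsBelow N (at (var n)) = n < N
VarsBelow N (at (par n)) = ⊤
VarsBelow N ⊥′           = ⊤
VarsBelow N (A ∧ B)      = VarsBelow N A × VarsBelow N B
VarsBelow N (A ∨ B)      = VarsBelow N A × VarsBelow N B
VarsBelow N (A ⇒ B)      = VarsBelow N A × VarsBelow N B

varBound : Form → ℕ
varBound (at (var n)) = suc n
varBound (at (par n)) = 0
varBound ⊥′           = 0
varBound (A ∧ B)      = varBound A ⊔ varBound B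
varBound (A ∨ B)      = varBound A ⊔ varBound B
varBound (A ⇒ B)      = varBound A ⊔ varBound B

VarsBelow-mono : ∀ {N M} → N ≤ M → ∀ B → VarsBelow N B → VarsBelow M B
VarsBelow-mono N≤M (at (var n)) n<N     = <-≤-trans n<N N≤M
VarsBelow-mono N≤M (at (par n)) _       = tt
VarsBelow-mono N≤M ⊥′           _       = tt
VarsBelow-mono N≤M (A ∧ B)      (p , q) = VarsBelow-mono N≤M A p , VarsBelow-mono N≤M B q
VarsBelow-mono N≤M (A ∨ B)      (p , q) = VarsBelow-mono N≤M A p , VarsBelow-mono N≤M B q
VarsBelow-mono N≤M (A ⇒ B)      (p , q) = VarsBelow-mono N≤M A p , VarsBelow-mono N≤M B q

VarsBelow-⊔ : ∀ {N M} A B → VarsBelow N A → VarsBelow M B →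
              VarsBelow (N ⊔ M) A × VarsBelow (N ⊔ M) B
VarsBelow-⊔ {N} {M} A B p q = VarsBelow-mono (m≤m⊔n N M) A p , VarsBelow-mono (m≤n⊔m N M) B q

VarsBelow-varBound : ∀ B → VarsBelow (varBound B) B
VarsBelow-varBound (at (var n)) = n<1+n n
VarsBelow-varBound (at (par n)) = tt
VarsBelow-varBound ⊥′           = tt
VarsBelow-varBound (A ∧ B) = VarsBelow-⊔ A B (VarsBelow-varBound A) (VarsBelow-varBound B)
VarsBelow-varBound (A ∨ B) = VarsBelow-⊔ A B (VarsBelow-varBound A) (VarsBelow-varBound B)
VarsBelow-varBound (A ⇒ B) = VarsBelow-⊔ A B (VarsBelow-varBound A) (VarsBelow-varBound B)

VarsBelow-zero : ∀ B → VarsBelow 0 B → ParOnly B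
VarsBelow-zero (at (par n)) _       = par-at n
VarsBelow-zero ⊥′           _       = par-⊥
VarsBelow-zero (A ∧ B)      (p , q) = par-∧ (VarsBelow-zero A p) (VarsBelow-zero B q)
VarsBelow-zero (A ∨ B)      (p , q) = par-∨ (VarsBelow-zero A p) (VarsBelow-zero B q)
VarsBelow-zero (A ⇒ B)      (p , q) = par-⇒ (VarsBelow-zero A p) (VarsBelow-zero B q)

VarsBelow-instantiate : ∀ {N c} → VarsBelow N c →
                        ∀ B → VarsBelow (suc N) B → VarsBelow N (B ⟨ N ≔ c ⟩)
VarsBelow-instantiate {N} vc (at (var n)) (s≤s n≤N) with n ≟ N
... | yes _ = vc
... | no n≢N = ≤∧≢⇒< n≤N n≢N
VarsBelow-instantiate vc (at (par n)) _       = tt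
VarsBelow-instantiate vc ⊥′           _       = tt
VarsBelow-instantiate vc (A ∧ B)      (p , q) = VarsBelow-instantiate vc A p , VarsBelow-instantiate vc B q
VarsBelow-instantiate vc (A ∨ B)      (p , q) = VarsBelow-instantiate vc A p , VarsBelow-instantiate vc B q
VarsBelow-instantiate vc (A ⇒ B)      (p , q) = VarsBelow-instantiate vc A p , VarsBelow-instantiate vc B q

-- Eliminating the variables

-- σ(B) is equivalent to ∃vars. B; the converse of σ-sat holds for every σ.
record ExistentialSubst (B : Form) : Set where
  field
    σ     : Subst
    σ-par : ∀ n → ParOnly (σ n)
    σ-sat : ∀ {v w} → w ≈ᵖ v → w ⊨ B → v ⊨ subst σ B

ExistentialSubst-ParOnly : ∀ {B} → ParOnly B → ExistentialSubst B
ExistentialSubst-ParOnly {B} pB = record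
  { σ     = λ _ → ⊥′
  ; σ-par = λ _ → par-⊥
  ; σ-sat = λ {v} {w} w≈v ⊨B → trans (subst-⟦⟧ B (λ _ → refl))
                                     (trans (ParOnly-⟦⟧ pB (λ n → sym (w≈v n))) ⊨B)
  }

ExistentialSubst-step : ∀ B N → ExistentialSubst (B ⟨ N ≔ ⊤′ ⟩ ∨ B ⟨ N ≔ ⊥′ ⟩) → ExistentialSubst B
ExistentialSubst-step B N S = record
  { σ     = σ [ N ↦ subst σ B⊤ ]
  ; σ-par = [↦]-pointwise {P = ParOnly} (ParOnly-subst σ-par B⊤) σ-par
  ; σ-sat = sat
  }
  where
  open ExistentialSubst S
  B⊤ = B ⟨ N ≔ ⊤′ ⟩
  B⊥ = B ⟨ N ≔ ⊥′ ⟩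

  sat : ∀ {v w} → w ≈ᵖ v → w ⊨ B → v ⊨ subst (σ [ N ↦ subst σ B⊤ ]) B
  sat {v} w≈v ⊨B = trans (subst-⟦⟧ B (∘ˢ-update (λ _ → refl)))
                         (pick (⟦ subst σ B⊤ ⟧ v) refl (σ-sat w≈v (shannon-expansion B N ⊨B)))
    where
    via : ∀ c → ⟦ B ⟧ ((v ∘ˢ σ) [ var N ≔ ⟦ c ⟧ (v ∘ˢ σ) ]) ≡ ⟦ subst σ (B ⟨ N ≔ c ⟩) ⟧ v
    via c = sym (trans (subst-⟦⟧ (B ⟨ N ≔ c ⟩) (λ _ → refl)) (instantiate-⟦⟧ B (v ∘ˢ σ)))

    pick : ∀ b → ⟦ subst σ B⊤ ⟧ v ≡ b → v ⊨ subst σ B⊤ ∨ subst σ B⊥ →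
           ⟦ B ⟧ ((v ∘ˢ σ) [ var N ≔ b ]) ≡ true
    pick true  ⊨σB⊤ _   = trans (via ⊤′) ⊨σB⊤
    pick false ⊭σB⊤ ⊨σ∨ = trans (via ⊥′) (∨-resolve ⊭σB⊤ ⊨σ∨)
      where
      ∨-resolve : ∀ {b c} → b ≡ false → b ∨ᵇ c ≡ true → c ≡ true
      ∨-resolve refl ⊨c = ⊨c

existentialSubst : ∀ A → ExistentialSubst A
existentialSubst A = below (varBound A) A (VarsBelow-varBound A)
  where
  below : ∀ N B → VarsBelow N B → ExistentialSubst B
  below zero    B vb = ExistentialSubst-ParOnly (VarsBelow-zero B vb)
  below (suc N) B vb = ExistentialSubst-step B N
    (below N _ (VarsBelow-instantiate (tt , tt) B vb , VarsBelow-instantiate tt B vb))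

-- Löwenheim's substitution

löwenheim : Form → Subst → Subst
löwenheim B θ n = (B ∧ at (var n)) ∨ (¬′ B ∧ θ n)

∘ˢ-löwenheim-⊨ : ∀ {B θ v} → v ⊨ B → v ∘ˢ löwenheim B θ ≗ v
∘ˢ-löwenheim-⊨ {v = v} ⊨B (var n) rewrite ⊨B = ∨-identityʳ (v (var n))
∘ˢ-löwenheim-⊨ ⊨B (par n) = refl

∘ˢ-löwenheim-⊭ : ∀ {B θ v} → ⟦ B ⟧ v ≡ false → v ∘ˢ löwenheim B θ ≗ v ∘ˢ θ
∘ˢ-löwenheim-⊭ ⊭B (var n) rewrite ⊭B = refl
∘ˢ-löwenheim-⊭ ⊭B (par n) = refl

löwenheim-isIdentity : ∀ B θ → IsIdentity B (löwenheim B θ)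
löwenheim-isIdentity B θ a = complete₁ λ v ⊨B →
  ⇔-⊨ (subst (löwenheim B θ) (at a)) (at a) (subst-⟦⟧ (at a) (∘ˢ-löwenheim-⊨ ⊨B))

löwenheim-EProjective : ∀ {B E} θ → (∀ v → v ⊨ B → v ⊨ subst θ B) →
                        (∀ v → ⟦ subst θ B ⟧ v ≡ ⟦ E ⟧ v) → EProjective E B
löwenheim-EProjective {B} {E} θ B⊨θB θB≡E =
  löwenheim B θ , löwenheim-isIdentity B θ , complete-⇔ fier
  where
  open ≡-Reasoning
  fier : ∀ v → ⟦ subst (löwenheim B θ) B ⟧ v ≡ ⟦ E ⟧ v
  fier v with ⟦ B ⟧ v in eq
  ... | true = begin
    ⟦ subst (löwenheim B θ) B ⟧ v ≡⟨ subst-⟦⟧ B (∘ˢ-löwenheim-⊨ eq) ⟩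
    ⟦ B ⟧ v                       ≡⟨ eq ⟩
    true                          ≡⟨ sym (B⊨θB v eq) ⟩
    ⟦ subst θ B ⟧ v               ≡⟨ θB≡E v ⟩
    ⟦ E ⟧ v                       ∎
  ... | false = begin
    ⟦ subst (löwenheim B θ) B ⟧ v ≡⟨ subst-⟦⟧ B (∘ˢ-löwenheim-⊭ eq) ⟩
    ⟦ B ⟧ (v ∘ˢ θ)                ≡⟨ sym (subst-⟦⟧ B (λ _ → refl)) ⟩
    ⟦ subst θ B ⟧ v               ≡⟨ θB≡E v ⟩
    ⟦ E ⟧ v                       ∎

theorem3p5 : (∀ (A : Form) → ParProjective A)
           × (∀ (A U : Form) → IsUPI A U → Projective (U ⇒ A))
theorem3p5 = parProjective , upi⇒-projective
  where
  parProjective : ∀ A → ParProjective A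
  parProjective A =
    subst σ A , ParOnly-subst σ-par A , löwenheim-EProjective σ (λ _ → σ-sat (λ _ → refl)) (λ _ → refl)
    where open ExistentialSubst (existentialSubst A)

  upi⇒-projective : ∀ A U → IsUPI A U → Projective (U ⇒ A)
  upi⇒-projective A U (U-par , _ , U-uniform) =
    löwenheim-EProjective σ (λ v _ → ⊨σ[U⇒A] v) ⊨σ[U⇒A]
    where
    open ExistentialSubst (existentialSubst A)
    ⊢U⇒σA : ⊢ U ⇒ subst σ A
    ⊢U⇒σA = U-uniform (subst σ A) (ParOnly-subst σ-par A)
              (complete λ _ → ⇒-⊨ A (subst σ A) (σ-sat (λ _ → refl)))
    ⊨σ[U⇒A] : ∀ v → v ⊨ subst σ (U ⇒ A)
    ⊨σ[U⇒A] v rewrite subst-ParOnly U-par σ = sound ⊢U⇒σA v []
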